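{- Let $X$ and $Y$ be connected simply-laced Dynkin diagrams (finite type $ADE$ or affine type extended $ADE$) with bipartite underlying graphs, and let $X\square Y$ be their box product quiver. Then: (1) if $X$ and $Y$ are both of finite type, $X\square Y$ has a strictly subadditive labelling; (2) if $X$ is of finite type and $Y$ is an extended Dynkin diagram of affine type, $X\square Y$ has a subadditive labelling; (3) if $X$ and $Y$ are both extended Dynkin diagrams of affine type, $X\square Y$ has a weakly subadditive labelling.
   Context: Box product. For graphs $Q=Q_0\sqcup Q_1$ and $Q'=Q_0'\sqcup Q_1'$, possibly with multiple edges and with all edges between the two parts, the box product $Q\square Q'$ has vertex set $Q\times Q'$. Each edge $q_1'q_2'$ of $Q'$ and each $q\in Q$ gives an edge between $(q,q_1')$ and $(q,q_2')$. Each edge $q_1q_2$ of $Q$ and each $q'\in Q'$ gives an edge between $(q_1,q')$ and $(q_2,q')$. Edges are oriented from $Q_0\times Q_0'$ to $Q_1\times Q_0'$, from $Q_1\times Q_0'$ to $Q_1\times Q_1'$, from $Q_1\times Q_1'$ to $Q_0\times Q_1'$, and from $Q_0\times Q_1'$ to $Q_0\times Q_0'$. Labellings. A labelling $\nu$ of the vertices of a quiver by positive reals is subadditive if it satisfies two conditions. (i) For every vertex $z$, $\nu(z)\ge\frac12\max\bigl(\sum_{y\to z}\nu(y),\sum_{z\to y}\nu(y)\bigr)$, where the sums run over incoming, resp. outgoing, arrows counted with multiplicity. (ii) Whenever equality holds in (i), $\sum_{y\to z}\nu(y)\ne\sum_{z\to y}\nu(y)$. The labelling is strictly subadditive if the inequality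 in (i) is strict for every vertex. It is weakly subadditive if (i) holds, whether or not (ii) does. The extended diagram $A_1^{(1)}$ consists of two vertices joined by a double edge. -}

module Defs where

open import Data.Nat as ℕ using (ℕ; zero; suc; _∸_; _%_; _≡ᵇ_)
open import Data.Fin using (Fin; toℕ; _≟_)
open import Data.Bool as Bool using (Bool; true; false; if_then_else_; _∧_; _∨_; not)
open import Data.List using (List; []; _∷_; map; upTo; _++_)
open import Data.Product using (_×_; _,_)
open import Data.Integer using (+_)
open import Data.Rational using (ℚ; 0ℚ; ½; _/_; _+_; _*_; _⊔_; _≤_; _<_)
open import Relation.Nullary using (¬_; does)
open import Relation.Binary.PropositionalEquality using (_≡_; _≢_)

-- Finite multigraphs (no loops), given by a symmetric multiplicity function

record Graph : Set where
  field
    size : ℕ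
    mult : Fin size → Fin size → ℕ
open Graph public

edgeMult : List (ℕ × ℕ) → ℕ → ℕ → ℕ
edgeMult [] i j = 0
edgeMult ((a , b) ∷ es) i j =
  (if ((a ≡ᵇ i) ∧ (b ≡ᵇ j)) ∨ ((a ≡ᵇ j) ∧ (b ≡ᵇ i)) then 1 else 0) ℕ.+ edgeMult es i j

mkGraph : ℕ → List (ℕ × ℕ) → Graph
mkGraph n es = record { size = n ; mult = λ i j → edgeMult es (toℕ i) (toℕ j) }

pathEdges : ℕ → List (ℕ × ℕ)
pathEdges p = map (λ k → (k , suc k)) (upTo (p ∸ 1))

data FiniteADE : Set where
  A : ℕ → FiniteADE      -- A k  is  A_{k+1}   (k+1 vertices)
  D : ℕ → FiniteADE      -- D k  is  D_{k+4}   (k+4 vertices)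
  E6 E7 E8 : FiniteADE

finiteDiagram : FiniteADE → Graph
finiteDiagram (A k) = mkGraph (suc k) (pathEdges (suc k))
finiteDiagram (D k) = mkGraph (k ℕ.+ 4) ((k ℕ.+ 1 , k ℕ.+ 3) ∷ pathEdges (k ℕ.+ 3))
finiteDiagram E6 = mkGraph 6 ((2 , 5) ∷ pathEdges 5)
finiteDiagram E7 = mkGraph 7 ((2 , 6) ∷ pathEdges 6)
finiteDiagram E8 = mkGraph 8 ((2 , 7) ∷ pathEdges 7)

data AffineADE : Set where
  Ã : ℕ → AffineADE      -- Ã k  is  A_{k+1}^{(1)}  (k+2 vertices, a cycle;
                          --   Ã 0 = A_1^{(1)}: two vertices, double edge)
  D̃ : ℕ → AffineADE      -- D̃ k  is  D_{k+4}^{(1)}  (k+5 vertices)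
  Ẽ6 Ẽ7 Ẽ8 : AffineADE

cycleEdges : ℕ → List (ℕ × ℕ)
cycleEdges n = map (λ k → (k , suc k % suc n)) (upTo (suc n))

affineDiagram : AffineADE → Graph
affineDiagram (Ã k) = mkGraph (k ℕ.+ 2) (cycleEdges (suc k))
affineDiagram (D̃ k) =
  mkGraph (k ℕ.+ 5) ((1 , k ℕ.+ 3) ∷ (k ℕ.+ 1 , k ℕ.+ 4) ∷ pathEdges (k ℕ.+ 3))
affineDiagram Ẽ6 = mkGraph 7 ((2 , 5) ∷ (5 , 6) ∷ pathEdges 5)
affineDiagram Ẽ7 = mkGraph 8 ((3 , 7) ∷ pathEdges 7)
affineDiagram Ẽ8 = mkGraph 9 ((2 , 8) ∷ pathEdges 8)

-- Bipartitions: a colouring c with Q₀ = c⁻¹(false), Q₁ = c⁻¹(true),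
-- such that every edge goes between the two parts.

Colouring : Graph → Set
Colouring G = Fin (size G) → Bool

ProperColouring : (G : Graph) → Colouring G → Set
ProperColouring G c = ∀ i j → 0 ℕ.< mult G i j → c i ≢ c j

record Quiver : Set₁ where
  field
    Vertex : Set
    arrows : Vertex → Vertex → ℕ     -- number of arrows  y → z
open Quiver public

_==𝔹_ : Bool → Bool → Bool
b ==𝔹 c = does (b Bool.≟ c)

-- Box product X □ Y with the orientation
--  Q₀×Q₀' → Q₁×Q₀' → Q₁×Q₁' → Q₀×Q₁' → Q₀×Q₀'
boxArrows : (X Y : Graph) → Colouring X → Colouring Y →
            Fin (size X) × Fin (size Y) → Fin (size X) × Fin (size Y) → ℕ
boxArrows X Y cx cy (a , a') (b , b') =
  -- edges a' b' of Y in the copy {a} × Y : target lies in Q' part cx a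
  (if does (a ≟ b) ∧ not (cy a' ==𝔹 cy b') ∧ (cy b' ==𝔹 cx a)
     then mult Y a' b' else 0)
  ℕ.+
  -- edges a b of X in the copy X × {a'} : target lies in Q part (not cy a')
  (if does (a' ≟ b') ∧ not (cx a ==𝔹 cx b) ∧ (cx b ==𝔹 not (cy a'))
     then mult X a b else 0)

boxProduct : (X Y : Graph) → Colouring X → Colouring Y → Quiver
boxProduct X Y cx cy = record
  { Vertex = Fin (size X) × Fin (size Y)
  ; arrows = boxArrows X Y cx cy }

sumFin : ∀ n → (Fin n → ℚ) → ℚ
sumFin zero f = 0ℚ
sumFin (suc n) f = f Fin.zero + sumFin n (λ i → f (Fin.suc i))
  where import Data.Fin as Fin

ℕ→ℚ : ℕ → ℚ
ℕ→ℚ n = + n / 1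

module _ (X Y : Graph) (cx : Colouring X) (cy : Colouring Y) where

  private
    V = Fin (size X) × Fin (size Y)
    Q = boxProduct X Y cx cy

  Labelling : Set
  Labelling = V → ℚ

  Positive : Labelling → Set
  Positive ν = ∀ z → 0ℚ < ν z

  inSum : Labelling → V → ℚ
  inSum ν z = sumFin (size X) λ a → sumFin (size Y) λ a' →
                ℕ→ℚ (arrows Q (a , a') z) * ν (a , a')

  outSum : Labelling → V → ℚ
  outSum ν z = sumFin (size X) λ a → sumFin (size Y) λ a' →
                 ℕ→ℚ (arrows Q z (a , a')) * ν (a , a')

  CondI : Labelling → V → Set
  CondI ν z = ½ * (inSum ν z ⊔ outSum ν z) ≤ ν z

  CondII : Labelling → V → Set
  CondII ν z = ν z ≡ ½ * (inSum ν z ⊔ outSum ν z) → inSum ν z ≢ outSum ν z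

  IsStrictlySubadditive : Labelling → Set
  IsStrictlySubadditive ν = Positive ν × (∀ z → ½ * (inSum ν z ⊔ outSum ν z) < ν z)

  IsSubadditive : Labelling → Set
  IsSubadditive ν = Positive ν × (∀ z → CondI ν z × CondII ν z)

  IsWeaklySubadditive : Labelling → Set
  IsWeaklySubadditive ν = Positive ν × (∀ z → CondI ν z)

module Submission where

-- Take strictly subadditive (resp. additive) functions F on X and G on Y, which exist for
-- Dynkin (resp. extended Dynkin) diagrams, and label the box product by
-- ν(a, a') = F(a) G(a'). By the orientation of X □ Y, all arrows into a vertex (b, b')
-- run along one factor and all arrows out of it along the other, so one of the two sums
-- is at most F(b) · Σ_{a' — b'} G(a') ≤ 2 ν(b, b') and the other at most
-- Σ_{a — b} F(a) · G(b') ≤ 2 ν(b, b'), with strict inequality whenever the corresponding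
-- factor is of finite type. In the mixed case, if the two sums were equal, both would be
-- bounded by the strict one, so equality in (i) cannot occur.

open import Defs
open import Data.Bool using (true; false; T; not; _∧_; _∨_; if_then_else_)
open import Data.Bool.Properties using (∨-comm)
open import Data.Empty using (⊥-elim)
open import Data.Fin using (Fin; zero; suc; toℕ; _≟_)
open import Data.Fin.Properties using (toℕ<n; all?)
import Data.Integer as ℤ
import Data.Integer.Properties as ℤ
open import Data.List using (List; []; _∷_; _++_; _∷ʳ_; map; upTo; applyUpTo)
import Data.List.Properties as List
open import Data.List.Relation.Unary.All using (All)
open import Data.List.Relation.Unary.All.Properties using (applyUpTo⁺₁)
open import Data.Nat as ℕ using (ℕ; zero; suc; _+_; _*_; _∸_; _⊔_; _≤_; _<_; _≡ᵇ_; _<ᵇ_; z≤n; s≤s; z<s)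
open import Data.Nat.Coprimality using (1-coprimeTo) renaming (sym to coprime-sym)
open import Data.Nat.DivMod using (_%_; n%n≡0; m<n⇒m%n≡m)
import Data.Nat.Properties as ℕ
open import Data.Nat.Tactic.RingSolver using (solve-∀)
open import Data.Product using (_×_; _,_; Σ)
open import Data.Rational as ℚ using (ℚ; mkℚ; ½; _/_; *≤*; *<*; ↥_)
import Data.Rational.Properties as ℚ
open import Data.Sum using (_⊎_; inj₁; inj₂)
open import Data.Unit using (tt)
open import Data.Vec using (Vec; []; _∷_; lookup)
open import Function using (_∘_; id; const)
open import Relation.Binary.Definitions using (Decidable; Trans)
open import Relation.Binary.PropositionalEquality
open import Relation.Nullary using (does; yes; no)
open import Relation.Nullary.Decidable using (True; toWitness; dec-true; dec-false)
open import Algebra.Properties.Semiring.Sum ℕ.+-*-semiring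
  using (sum; sum-syntax; ∑-distrib-+; *-distribˡ-sum; *-distribʳ-sum; sum-cong-≗)
open import Algebra.Properties.CommutativeSemigroup ℕ.*-commutativeSemigroup using (x∙yz≈y∙xz)

∑-zero : ∀ n → ∑[ i < n ] 0 ≡ 0
∑-zero zero = refl
∑-zero (suc n) = ∑-zero n

∑-mono-≤ : ∀ {n} {f g : Fin n → ℕ} → (∀ i → f i ≤ g i) → sum f ≤ sum g
∑-mono-≤ {zero} f≤g = z≤n
∑-mono-≤ {suc n} f≤g = ℕ.+-mono-≤ (f≤g zero) (∑-mono-≤ (f≤g ∘ suc))

∑-if : ∀ {n} b (f : Fin n → ℕ) → ∑[ i < n ] (if b then f i else 0) ≡ (if b then sum f else 0)
∑-if true f = refl
∑-if {n} false f = ∑-zero n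

∑-δ : ∀ {n} (b : Fin n) (f : Fin n → ℕ) → ∑[ a < n ] (if does (a ≟ b) then f a else 0) ≡ f b
∑-δ {suc n} zero f = trans (cong (f zero +_) (∑-zero n)) (ℕ.+-identityʳ (f zero))
∑-δ {suc n} (suc b) f = ∑-δ b (f ∘ suc)

∑∑-cross-≤ : ∀ {m n} (b : Fin m) (b' : Fin n) {h : Fin m → Fin n → ℕ} (f : Fin n → ℕ) (g : Fin m → ℕ) →
  (∀ a a' → h a a' ≤ (if does (a ≟ b) then f a' else 0) + (if does (a' ≟ b') then g a else 0)) →
  ∑[ a < m ] ∑[ a' < n ] h a a' ≤ sum f + sum g
∑∑-cross-≤ {m} {n} b b' {h} f g h≤ = begin
  ∑[ a < m ] ∑[ a' < n ] h a a'
    ≤⟨ ∑-mono-≤ (λ a → ∑-mono-≤ (h≤ a)) ⟩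
  ∑[ a < m ] ∑[ a' < n ] (row a a' + column a a')
    ≡⟨ sum-cong-≗ (λ a → ∑-distrib-+ (row a) (column a)) ⟩
  ∑[ a < m ] (∑[ a' < n ] row a a' + ∑[ a' < n ] column a a')
    ≡⟨ ∑-distrib-+ (λ a → sum {n} (row a)) (λ a → sum {n} (column a)) ⟩
  ∑[ a < m ] ∑[ a' < n ] row a a' + ∑[ a < m ] ∑[ a' < n ] column a a'
    ≡⟨ cong₂ _+_ (trans (sum-cong-≗ (λ a → ∑-if (does (a ≟ b)) f)) (∑-δ b (λ _ → sum f)))
                 (sum-cong-≗ (λ a → ∑-δ b' (λ _ → g a))) ⟩
  sum f + sum g ∎
  where
  open ℕ.≤-Reasoning
  row : Fin m → Fin n → ℕ
  row a a' = if does (a ≟ b) then f a' else 0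
  column : Fin m → Fin n → ℕ
  column a a' = if does (a' ≟ b') then g a else 0

if-≤ : ∀ b x → (if b then x else 0) ≤ x
if-≤ true x = ℕ.≤-refl
if-≤ false x = z≤n

if-mono-≤ : ∀ b {x y} → x ≤ y → (if b then x else 0) ≤ (if b then y else 0)
if-mono-≤ true x≤y = x≤y
if-mono-≤ false x≤y = z≤n

guarded-*-≤ : ∀ {g c} → (T g → T c) → ∀ m w → (if g then m else 0) * w ≤ (if c then m * w else 0)
guarded-*-≤ {false} _ m w = z≤n
guarded-*-≤ {true} {true} _ m w = ℕ.≤-refl
guarded-*-≤ {true} {false} g⇒c m w = ⊥-elim (g⇒c tt)

T-∧-elimʳ : ∀ x {y} → T (x ∧ y) → T y
T-∧-elimʳ true t = t

==𝔹-not : ∀ x y → T (x ==𝔹 not y) → T (not (y ==𝔹 x))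
==𝔹-not false false ()
==𝔹-not false true _ = tt
==𝔹-not true false _ = tt
==𝔹-not true true ()

≢𝔹-≡𝔹-trans : ∀ x y z → T (not (x ==𝔹 y) ∧ (y ==𝔹 z)) → T (not (x ==𝔹 z))
≢𝔹-≡𝔹-trans false false _ ()
≢𝔹-≡𝔹-trans true true _ ()
≢𝔹-≡𝔹-trans false true false ()
≢𝔹-≡𝔹-trans false true true _ = tt
≢𝔹-≡𝔹-trans true false false _ = tt
≢𝔹-≡𝔹-trans true false true ()

≢𝔹-≡𝔹-not : ∀ x y z → T (not (x ==𝔹 y) ∧ (y ==𝔹 not z)) → T (z ==𝔹 x)
≢𝔹-≡𝔹-not false false _ ()
≢𝔹-≡𝔹-not true true _ ()
≢𝔹-≡𝔹-not false true false _ = tt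
≢𝔹-≡𝔹-not false true true ()
≢𝔹-≡𝔹-not true false false ()
≢𝔹-≡𝔹-not true false true _ = tt

Symmetric : Graph → Set
Symmetric G = ∀ i j → mult G i j ≡ mult G j i

neighbourSum : (G : Graph) → (Fin (size G) → ℕ) → Fin (size G) → ℕ
neighbourSum G F b = ∑[ a < size G ] (mult G a b * F a)

record SubadditiveFunction (_≺_ : ℕ → ℕ → Set) (G : Graph) : Set where
  field
    value : Fin (size G) → ℕ
    positive : ∀ i → 0 < value i
    subadditive : ∀ i → neighbourSum G value i ≺ (2 * value i)

Crosswise : ℕ → ℕ → ℕ → ℕ → Set
Crosswise I O P Q = (I ≤ P × O ≤ Q) ⊎ (I ≤ Q × O ≤ P)

crosswise-by : ∀ c {I O P Q} → I ≤ (if c then P else 0) + (if not c then Q else 0) →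
               O ≤ (if not c then P else 0) + (if c then Q else 0) → Crosswise I O P Q
crosswise-by true {P = P} I≤ O≤ = inj₁ (subst (_ ≤_) (ℕ.+-identityʳ P) I≤ , O≤)
crosswise-by false {P = P} I≤ O≤ = inj₂ (I≤ , subst (_ ≤_) (ℕ.+-identityʳ P) O≤)

crosswise-⊔ : ∀ {I O P Q} → Crosswise I O P Q → I ⊔ O ≤ P ⊔ Q
crosswise-⊔ (inj₁ (I≤P , O≤Q)) = ℕ.⊔-mono-≤ I≤P O≤Q
crosswise-⊔ {P = P} {Q} (inj₂ (I≤Q , O≤P)) =
  ℕ.≤-trans (ℕ.⊔-mono-≤ I≤Q O≤P) (ℕ.≤-reflexive (ℕ.⊔-comm Q P))

crosswise-≡ : ∀ {I O P Q} → Crosswise I O P Q → I ≡ O → I ⊔ O ≤ Q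
crosswise-≡ {I} (inj₁ (_ , O≤Q)) refl = ℕ.≤-trans (ℕ.≤-reflexive (ℕ.⊔-idem I)) O≤Q
crosswise-≡ {I} (inj₂ (I≤Q , _)) refl = ℕ.≤-trans (ℕ.≤-reflexive (ℕ.⊔-idem I)) I≤Q

_⊗_ : ∀ {m n} → (Fin m → ℕ) → (Fin n → ℕ) → Fin m × Fin n → ℕ
(F ⊗ G) (a , a') = F a * G a'

module _ (X Y : Graph) (cx : Colouring X) (cy : Colouring Y) where

  private
    V = Fin (size X) × Fin (size Y)
    arrow = boxArrows X Y cx cy

  -- The two summands of boxArrows, so that arrow z w ≡ arrowsAlongY z w + arrowsAlongX z w holds by refl.
  arrowsAlongY arrowsAlongX : V → V → ℕ
  arrowsAlongY (a , a') (b , b') =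
    if does (a ≟ b) ∧ not (cy a' ==𝔹 cy b') ∧ (cy b' ==𝔹 cx a) then mult Y a' b' else 0
  arrowsAlongX (a , a') (b , b') =
    if does (a' ≟ b') ∧ not (cx a ==𝔹 cx b) ∧ (cx b ==𝔹 not (cy a')) then mult X a b else 0

  inSumℕ outSumℕ : (V → ℕ) → V → ℕ
  inSumℕ ν z = ∑[ a < size X ] ∑[ a' < size Y ] (arrow (a , a') z * ν (a , a'))
  outSumℕ ν z = ∑[ a < size X ] ∑[ a' < size Y ] (arrow z (a , a') * ν (a , a'))

  module _ (symX : Symmetric X) (symY : Symmetric Y) (F : Fin (size X) → ℕ) (G : Fin (size Y) → ℕ)
           (b : Fin (size X)) (b' : Fin (size Y)) where

    private
      -- (b , b') receives its arrows along Y and emits them along X iff c holds.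
      c = cy b' ==𝔹 cx b
      yTerm : Fin (size Y) → ℕ
      yTerm a' = mult Y a' b' * (F b * G a')
      xTerm : Fin (size X) → ℕ
      xTerm a = mult X a b * (F a * G b')

    inSumℕ-term-≤ : ∀ a a' → arrow (a , a') (b , b') * (F ⊗ G) (a , a') ≤
      (if does (a ≟ b) then (if c then yTerm a' else 0) else 0) +
      (if does (a' ≟ b') then (if not c then xTerm a else 0) else 0)
    inSumℕ-term-≤ a a' = ℕ.≤-trans
      (ℕ.≤-reflexive (ℕ.*-distribʳ-+ ((F ⊗ G) (a , a'))
                                     (arrowsAlongY (a , a') (b , b')) (arrowsAlongX (a , a') (b , b'))))
      (ℕ.+-mono-≤ alongY alongX)
      where
      alongY : arrowsAlongY (a , a') (b , b') * (F a * G a') ≤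
               (if does (a ≟ b) then (if c then yTerm a' else 0) else 0)
      alongY with a ≟ b
      ... | yes refl = guarded-*-≤ (T-∧-elimʳ (not (cy a' ==𝔹 cy b'))) (mult Y a' b') (F b * G a')
      ... | no _ = z≤n
      alongX : arrowsAlongX (a , a') (b , b') * (F a * G a') ≤
               (if does (a' ≟ b') then (if not c then xTerm a else 0) else 0)
      alongX with a' ≟ b'
      ... | yes refl =
        guarded-*-≤ (==𝔹-not (cx b) (cy b') ∘ T-∧-elimʳ (not (cx a ==𝔹 cx b))) (mult X a b) (F a * G b')
      ... | no _ = z≤n

    outSumℕ-term-≤ : ∀ a a' → arrow (b , b') (a , a') * (F ⊗ G) (a , a') ≤
      (if does (a ≟ b) then (if not c then yTerm a' else 0) else 0) +
      (if does (a' ≟ b') then (if c then xTerm a else 0) else 0)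
    outSumℕ-term-≤ a a' = ℕ.≤-trans
      (ℕ.≤-reflexive (ℕ.*-distribʳ-+ ((F ⊗ G) (a , a'))
                                     (arrowsAlongY (b , b') (a , a')) (arrowsAlongX (b , b') (a , a'))))
      (ℕ.+-mono-≤ alongY alongX)
      where
      alongY : arrowsAlongY (b , b') (a , a') * (F a * G a') ≤
               (if does (a ≟ b) then (if not c then yTerm a' else 0) else 0)
      alongY with a ≟ b
      ... | yes refl rewrite dec-true (b ≟ b) refl | symY b' a' =
        guarded-*-≤ (≢𝔹-≡𝔹-trans (cy b') (cy a') (cx b)) (mult Y a' b') (F b * G a')
      ... | no a≢b rewrite dec-false (b ≟ a) (a≢b ∘ sym) = z≤n
      alongX : arrowsAlongX (b , b') (a , a') * (F a * G a') ≤
               (if does (a' ≟ b') then (if c then xTerm a else 0) else 0)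
      alongX with a' ≟ b'
      ... | yes refl rewrite dec-true (b' ≟ b') refl | symX b a =
        guarded-*-≤ (≢𝔹-≡𝔹-not (cx b) (cx a) (cy b')) (mult X a b) (F a * G b')
      ... | no a'≢b' rewrite dec-false (b' ≟ a') (a'≢b' ∘ sym) = z≤n

    yTerm-sum : sum yTerm ≡ F b * neighbourSum Y G b'
    yTerm-sum = trans (sum-cong-≗ (λ a' → x∙yz≈y∙xz (mult Y a' b') (F b) (G a')))
                      (sym (*-distribˡ-sum (F b) (λ a' → mult Y a' b' * G a')))

    xTerm-sum : sum xTerm ≡ neighbourSum X F b * G b'
    xTerm-sum = trans (sum-cong-≗ (λ a → sym (ℕ.*-assoc (mult X a b) (F a) (G b'))))
                      (sym (*-distribʳ-sum (G b') (λ a → mult X a b * F a)))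

    inSumℕ-outSumℕ-crosswise : Crosswise (inSumℕ (F ⊗ G) (b , b')) (outSumℕ (F ⊗ G) (b , b'))
                                         (F b * neighbourSum Y G b') (neighbourSum X F b * G b')
    inSumℕ-outSumℕ-crosswise = subst₂ (Crosswise _ _) yTerm-sum xTerm-sum (crosswise-by c
      (ℕ.≤-trans (∑∑-cross-≤ b b' _ _ inSumℕ-term-≤)
                 (ℕ.≤-reflexive (cong₂ _+_ (∑-if c yTerm) (∑-if (not c) xTerm))))
      (ℕ.≤-trans (∑∑-cross-≤ b b' _ _ outSumℕ-term-≤)
                 (ℕ.≤-reflexive (cong₂ _+_ (∑-if (not c) yTerm) (∑-if c xTerm)))))

ℕ→ℚ-mkℚ : ∀ n → ℕ→ℚ n ≡ mkℚ (ℤ.+ n) 0 (coprime-sym (1-coprimeTo n))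
ℕ→ℚ-mkℚ n = ℚ.normalize-coprime _

ℕ→ℚ-+ : ∀ m n → ℕ→ℚ (m + n) ≡ ℕ→ℚ m ℚ.+ ℕ→ℚ n
ℕ→ℚ-+ m n = begin
  ℕ→ℚ (m + n)
    ≡⟨ cong₂ (λ x y → (x ℤ.+ y) / 1) (ℤ.*-identityʳ (ℤ.+ m)) (ℤ.*-identityʳ (ℤ.+ n)) ⟨
  (ℤ.+ m ℤ.* ℤ.+ 1 ℤ.+ ℤ.+ n ℤ.* ℤ.+ 1) / 1
    ≡⟨ cong₂ ℚ._+_ (ℕ→ℚ-mkℚ m) (ℕ→ℚ-mkℚ n) ⟨
  ℕ→ℚ m ℚ.+ ℕ→ℚ n ∎
  where open ≡-Reasoning

ℕ→ℚ-* : ∀ m n → ℕ→ℚ (m * n) ≡ ℕ→ℚ m ℚ.* ℕ→ℚ n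
ℕ→ℚ-* m n = begin
  ℕ→ℚ (m * n)              ≡⟨ cong (_/ 1) (ℤ.pos-* m n) ⟩
  (ℤ.+ m ℤ.* ℤ.+ n) / 1    ≡⟨ cong₂ ℚ._*_ (ℕ→ℚ-mkℚ m) (ℕ→ℚ-mkℚ n) ⟨
  ℕ→ℚ m ℚ.* ℕ→ℚ n          ∎
  where open ≡-Reasoning

ℕ→ℚ-mono-≤ : ∀ {m n} → m ≤ n → ℕ→ℚ m ℚ.≤ ℕ→ℚ n
ℕ→ℚ-mono-≤ {m} {n} m≤n = subst₂ ℚ._≤_ (sym (ℕ→ℚ-mkℚ m)) (sym (ℕ→ℚ-mkℚ n))
  (*≤* (ℤ.*-monoʳ-≤-nonNeg (ℤ.+ 1) (ℤ.+≤+ m≤n)))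

ℕ→ℚ-mono-< : ∀ {m n} → m < n → ℕ→ℚ m ℚ.< ℕ→ℚ n
ℕ→ℚ-mono-< {m} {n} m<n = subst₂ ℚ._<_ (sym (ℕ→ℚ-mkℚ m)) (sym (ℕ→ℚ-mkℚ n))
  (*<* (ℤ.*-monoʳ-<-pos (ℤ.+ 1) (ℤ.+<+ m<n)))

ℕ→ℚ-injective : ∀ {m n} → ℕ→ℚ m ≡ ℕ→ℚ n → m ≡ n
ℕ→ℚ-injective {m} {n} eq = ℤ.+-injective (begin
  ℤ.+ m        ≡⟨ cong ↥_ (ℕ→ℚ-mkℚ m) ⟨
  ↥ ℕ→ℚ m      ≡⟨ cong ↥_ eq ⟩
  ↥ ℕ→ℚ n      ≡⟨ cong ↥_ (ℕ→ℚ-mkℚ n) ⟩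
  ℤ.+ n        ∎)
  where open ≡-Reasoning

ℕ→ℚ-⊔ : ∀ m n → ℕ→ℚ (m ⊔ n) ≡ ℕ→ℚ m ℚ.⊔ ℕ→ℚ n
ℕ→ℚ-⊔ m n with ℕ.≤-total m n
... | inj₁ m≤n = trans (cong ℕ→ℚ (ℕ.m≤n⇒m⊔n≡n m≤n))
                      (sym (ℚ.p≤q⇒p⊔q≡q (ℕ→ℚ-mono-≤ m≤n)))
... | inj₂ n≤m = trans (cong ℕ→ℚ (ℕ.m≥n⇒m⊔n≡m n≤m))
                      (sym (ℚ.p≥q⇒p⊔q≡p (ℕ→ℚ-mono-≤ n≤m)))

½*ℕ→ℚ-2* : ∀ n → ½ ℚ.* ℕ→ℚ (2 * n) ≡ ℕ→ℚ n
½*ℕ→ℚ-2* n = begin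
  ½ ℚ.* ℕ→ℚ (2 * n)            ≡⟨ cong (½ ℚ.*_) (ℕ→ℚ-* 2 n) ⟩
  ½ ℚ.* (ℕ→ℚ 2 ℚ.* ℕ→ℚ n)      ≡⟨ ℚ.*-assoc ½ (ℕ→ℚ 2) (ℕ→ℚ n) ⟨
  (½ ℚ.* ℕ→ℚ 2) ℚ.* ℕ→ℚ n      ≡⟨ ℚ.*-identityˡ (ℕ→ℚ n) ⟩
  ℕ→ℚ n                        ∎
  where open ≡-Reasoning

½*ℕ→ℚ-< : ∀ {m} n → m < 2 * n → ½ ℚ.* ℕ→ℚ m ℚ.< ℕ→ℚ n
½*ℕ→ℚ-< {m} n m<2n =
  subst (½ ℚ.* ℕ→ℚ m ℚ.<_) (½*ℕ→ℚ-2* n) (ℚ.*-monoʳ-<-pos ½ (ℕ→ℚ-mono-< m<2n))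

½*ℕ→ℚ-≤ : ∀ {m} n → m ≤ 2 * n → ½ ℚ.* ℕ→ℚ m ℚ.≤ ℕ→ℚ n
½*ℕ→ℚ-≤ {m} n m≤2n =
  subst (½ ℚ.* ℕ→ℚ m ℚ.≤_) (½*ℕ→ℚ-2* n) (ℚ.*-monoˡ-≤-nonNeg ½ (ℕ→ℚ-mono-≤ m≤2n))

sumFin-ℕ→ℚ : ∀ n {f : Fin n → ℚ} {g : Fin n → ℕ} →
             (∀ i → f i ≡ ℕ→ℚ (g i)) → sumFin n f ≡ ℕ→ℚ (sum g)
sumFin-ℕ→ℚ zero f≡g = refl
sumFin-ℕ→ℚ (suc n) {g = g} f≡g =
  trans (cong₂ ℚ._+_ (f≡g zero) (sumFin-ℕ→ℚ n (f≡g ∘ suc))) (sym (ℕ→ℚ-+ (g zero) _))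

module _ (X Y : Graph) (cx : Colouring X) (cy : Colouring Y) (ν : Fin (size X) × Fin (size Y) → ℕ) where

  inSum-ℕ→ℚ : ∀ z → inSum X Y cx cy (ℕ→ℚ ∘ ν) z ≡ ℕ→ℚ (inSumℕ X Y cx cy ν z)
  inSum-ℕ→ℚ z = sumFin-ℕ→ℚ _ λ a → sumFin-ℕ→ℚ _ λ a' →
    sym (ℕ→ℚ-* (boxArrows X Y cx cy (a , a') z) (ν (a , a')))

  outSum-ℕ→ℚ : ∀ z → outSum X Y cx cy (ℕ→ℚ ∘ ν) z ≡ ℕ→ℚ (outSumℕ X Y cx cy ν z)
  outSum-ℕ→ℚ z = sumFin-ℕ→ℚ _ λ a → sumFin-ℕ→ℚ _ λ a' →
    sym (ℕ→ℚ-* (boxArrows X Y cx cy z (a , a')) (ν (a , a')))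

  ½*inSum⊔outSum : ∀ z → ½ ℚ.* (inSum X Y cx cy (ℕ→ℚ ∘ ν) z ℚ.⊔ outSum X Y cx cy (ℕ→ℚ ∘ ν) z)
                         ≡ ½ ℚ.* ℕ→ℚ (inSumℕ X Y cx cy ν z ⊔ outSumℕ X Y cx cy ν z)
  ½*inSum⊔outSum z = cong (½ ℚ.*_) (trans (cong₂ ℚ._⊔_ (inSum-ℕ→ℚ z) (outSum-ℕ→ℚ z))
                                          (sym (ℕ→ℚ-⊔ (inSumℕ X Y cx cy ν z) (outSumℕ X Y cx cy ν z))))

  ½*inSum⊔outSum-< : ∀ z → inSumℕ X Y cx cy ν z ⊔ outSumℕ X Y cx cy ν z < 2 * ν z →
    ½ ℚ.* (inSum X Y cx cy (ℕ→ℚ ∘ ν) z ℚ.⊔ outSum X Y cx cy (ℕ→ℚ ∘ ν) z) ℚ.< ℕ→ℚ (ν z)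
  ½*inSum⊔outSum-< z <2ν =
    subst (ℚ._< ℕ→ℚ (ν z)) (sym (½*inSum⊔outSum z)) (½*ℕ→ℚ-< (ν z) <2ν)

  ½*inSum⊔outSum-≤ : ∀ z → inSumℕ X Y cx cy ν z ⊔ outSumℕ X Y cx cy ν z ≤ 2 * ν z →
    ½ ℚ.* (inSum X Y cx cy (ℕ→ℚ ∘ ν) z ℚ.⊔ outSum X Y cx cy (ℕ→ℚ ∘ ν) z) ℚ.≤ ℕ→ℚ (ν z)
  ½*inSum⊔outSum-≤ z ≤2ν =
    subst (ℚ._≤ ℕ→ℚ (ν z)) (sym (½*inSum⊔outSum z)) (½*ℕ→ℚ-≤ (ν z) ≤2ν)

*-boundʳ-< : ∀ {x} f g → x < 2 * f → 0 < g → x * g < 2 * (f * g)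
*-boundʳ-< {x} f g@(suc _) x<2f _ = subst (x * g <_) (ℕ.*-assoc 2 f g) (ℕ.*-monoˡ-< g x<2f)

*-boundʳ-≤ : ∀ {x} f g → x ≤ 2 * f → x * g ≤ 2 * (f * g)
*-boundʳ-≤ {x} f g x≤2f = subst (x * g ≤_) (ℕ.*-assoc 2 f g) (ℕ.*-monoˡ-≤ g x≤2f)

*-boundˡ-< : ∀ {y} f g → y < 2 * g → 0 < f → f * y < 2 * (f * g)
*-boundˡ-< {y} f g y<2g 0<f = subst₂ _<_ (ℕ.*-comm y f) (cong (2 *_) (ℕ.*-comm g f)) (*-boundʳ-< g f y<2g 0<f)

*-boundˡ-≤ : ∀ {y} f g → y ≤ 2 * g → f * y ≤ 2 * (f * g)
*-boundˡ-≤ {y} f g y≤2g = subst₂ _≤_ (ℕ.*-comm y f) (cong (2 *_) (ℕ.*-comm g f)) (*-boundʳ-≤ g f y≤2g)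

module _ {X Y : Graph} (cx : Colouring X) (cy : Colouring Y) {_≺₁_ _≺₂_ : ℕ → ℕ → Set}
         (φ : SubadditiveFunction _≺₁_ X) (ψ : SubadditiveFunction _≺₂_ Y) where

  open SubadditiveFunction φ renaming (value to F; positive to F-positive)
  open SubadditiveFunction ψ renaming (value to G; positive to G-positive)

  productLabelling : Labelling X Y cx cy
  productLabelling = ℕ→ℚ ∘ (F ⊗ G)

  productLabelling-positive : Positive X Y cx cy productLabelling
  productLabelling-positive (a , a') = ℕ→ℚ-mono-< (ℕ.*-mono-< (F-positive a) (G-positive a'))

  module _ (symX : Symmetric X) (symY : Symmetric Y) (b : Fin (size X)) (b' : Fin (size Y)) where

    private
      I = inSumℕ X Y cx cy (F ⊗ G) (b , b')
      O = outSumℕ X Y cx cy (F ⊗ G) (b , b')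
      crosswise = inSumℕ-outSumℕ-crosswise X Y cx cy symX symY F G b b'

    inSumℕ⊔outSumℕ-< : neighbourSum X F b < 2 * F b → neighbourSum Y G b' < 2 * G b' →
                       I ⊔ O < 2 * (F b * G b')
    inSumℕ⊔outSumℕ-< X< Y< = ℕ.≤-<-trans (crosswise-⊔ crosswise)
      (ℕ.⊔-lub (*-boundˡ-< (F b) (G b') Y< (F-positive b)) (*-boundʳ-< (F b) (G b') X< (G-positive b')))

    inSumℕ⊔outSumℕ-≤ : neighbourSum X F b ≤ 2 * F b → neighbourSum Y G b' ≤ 2 * G b' →
                       I ⊔ O ≤ 2 * (F b * G b')
    inSumℕ⊔outSumℕ-≤ X≤ Y≤ = ℕ.≤-trans (crosswise-⊔ crosswise)
      (ℕ.⊔-lub (*-boundˡ-≤ (F b) (G b') Y≤) (*-boundʳ-≤ (F b) (G b') X≤))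

    inSumℕ≡outSumℕ-< : neighbourSum X F b < 2 * F b → I ≡ O → I ⊔ O < 2 * (F b * G b')
    inSumℕ≡outSumℕ-< X< I≡O =
      ℕ.≤-<-trans (crosswise-≡ crosswise I≡O) (*-boundʳ-< (F b) (G b') X< (G-positive b'))

module _ {X Y : Graph} (symX : Symmetric X) (symY : Symmetric Y) (cx : Colouring X) (cy : Colouring Y) where

  open SubadditiveFunction using (value; subadditive)

  box-strictlySubadditive : SubadditiveFunction _<_ X → SubadditiveFunction _<_ Y →
                            Σ (Labelling X Y cx cy) (IsStrictlySubadditive X Y cx cy)
  box-strictlySubadditive φ ψ = productLabelling cx cy φ ψ , productLabelling-positive cx cy φ ψ , λ (b , b') →
    ½*inSum⊔outSum-< X Y cx cy (value φ ⊗ value ψ) (b , b')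
      (inSumℕ⊔outSumℕ-< cx cy φ ψ symX symY b b' (subadditive φ b) (subadditive ψ b'))

  box-weaklySubadditive : SubadditiveFunction _≤_ X → SubadditiveFunction _≤_ Y →
                          Σ (Labelling X Y cx cy) (IsWeaklySubadditive X Y cx cy)
  box-weaklySubadditive φ ψ = productLabelling cx cy φ ψ , productLabelling-positive cx cy φ ψ , λ (b , b') →
    ½*inSum⊔outSum-≤ X Y cx cy (value φ ⊗ value ψ) (b , b')
      (inSumℕ⊔outSumℕ-≤ cx cy φ ψ symX symY b b' (subadditive φ b) (subadditive ψ b'))

  box-subadditive : SubadditiveFunction _<_ X → SubadditiveFunction _≤_ Y →
                    Σ (Labelling X Y cx cy) (IsSubadditive X Y cx cy)
  box-subadditive φ ψ =
    productLabelling cx cy φ ψ , productLabelling-positive cx cy φ ψ , λ (b , b') → condI b b' , condII b b'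
    where
    ν = value φ ⊗ value ψ
    condI : ∀ b b' → CondI X Y cx cy (productLabelling cx cy φ ψ) (b , b')
    condI b b' = ½*inSum⊔outSum-≤ X Y cx cy ν (b , b')
      (inSumℕ⊔outSumℕ-≤ cx cy φ ψ symX symY b b' (ℕ.<⇒≤ (subadditive φ b)) (subadditive ψ b'))
    condII : ∀ b b' → CondII X Y cx cy (productLabelling cx cy φ ψ) (b , b')
    condII b b' ν≡½max in≡out = ℚ.<-irrefl (sym ν≡½max) (½*inSum⊔outSum-< X Y cx cy ν (b , b')
      (inSumℕ≡outSumℕ-< cx cy φ ψ symX symY b b' (subadditive φ b) (ℕ→ℚ-injective (begin
        ℕ→ℚ (inSumℕ X Y cx cy ν (b , b'))    ≡⟨ inSum-ℕ→ℚ X Y cx cy ν (b , b') ⟨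
        inSum X Y cx cy (ℕ→ℚ ∘ ν) (b , b')   ≡⟨ in≡out ⟩
        outSum X Y cx cy (ℕ→ℚ ∘ ν) (b , b')  ≡⟨ outSum-ℕ→ℚ X Y cx cy ν (b , b') ⟩
        ℕ→ℚ (outSumℕ X Y cx cy ν (b , b'))   ∎))))
      where open ≡-Reasoning

edgeMult-sym : ∀ es i j → edgeMult es i j ≡ edgeMult es j i
edgeMult-sym [] i j = refl
edgeMult-sym ((u , v) ∷ es) i j = cong₂ _+_
  (cong (if_then 1 else 0) (∨-comm ((u ≡ᵇ i) ∧ (v ≡ᵇ j)) ((u ≡ᵇ j) ∧ (v ≡ᵇ i)))) (edgeMult-sym es i j)

mkGraph-symmetric : ∀ n es → Symmetric (mkGraph n es)
mkGraph-symmetric n es i j = edgeMult-sym es (toℕ i) (toℕ j)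

edgeNeighbourSum : ℕ × ℕ → (ℕ → ℕ) → ℕ → ℕ
edgeNeighbourSum (u , v) H j = (if v ≡ᵇ j then H u else 0) + (if u ≡ᵇ j then H v else 0)

listNeighbourSum : List (ℕ × ℕ) → (ℕ → ℕ) → ℕ → ℕ
listNeighbourSum [] H j = 0
listNeighbourSum (e ∷ es) H j = edgeNeighbourSum e H j + listNeighbourSum es H j

listNeighbourSum-++ : ∀ es fs H j →
  listNeighbourSum (es ++ fs) H j ≡ listNeighbourSum es H j + listNeighbourSum fs H j
listNeighbourSum-++ [] fs H j = refl
listNeighbourSum-++ (e ∷ es) fs H j = trans (cong (edgeNeighbourSum e H j +_) (listNeighbourSum-++ es fs H j))
  (sym (ℕ.+-assoc (edgeNeighbourSum e H j) (listNeighbourSum es H j) _))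

∑-indicator-≤ : ∀ n u (H : ℕ → ℕ) → ∑[ a < n ] (if u ≡ᵇ toℕ a then H (toℕ a) else 0) ≤ H u
∑-indicator-≤ zero u H = z≤n
∑-indicator-≤ (suc n) zero H = ℕ.≤-reflexive (trans (cong (H 0 +_) (∑-zero n)) (ℕ.+-identityʳ (H 0)))
∑-indicator-≤ (suc n) (suc u) H = ∑-indicator-≤ n u (H ∘ suc)

∑-indicator : ∀ m u (H : ℕ → ℕ) →
              ∑[ i < m ] (if toℕ i ≡ᵇ u then H (toℕ i) else 0) ≡ (if u <ᵇ m then H u else 0)
∑-indicator zero u H = refl
∑-indicator (suc m) zero H = trans (cong (H 0 +_) (∑-zero m)) (ℕ.+-identityʳ (H 0))
∑-indicator (suc m) (suc u) H = ∑-indicator m u (H ∘ suc)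

edgeIndicator-≤ : ∀ p q r s h → (if (p ∧ q) ∨ (r ∧ s) then 1 else 0) * h ≤
                  (if q then (if p then h else 0) else 0) + (if r then (if s then h else 0) else 0)
edgeIndicator-≤ true true r s h = ℕ.≤-trans (ℕ.≤-reflexive (ℕ.+-identityʳ h)) (ℕ.m≤m+n h _)
edgeIndicator-≤ false q true true h = ℕ.≤-trans (ℕ.≤-reflexive (ℕ.+-identityʳ h)) (ℕ.m≤n+m h _)
edgeIndicator-≤ true false true true h = ℕ.≤-reflexive (ℕ.+-identityʳ h)
edgeIndicator-≤ true false true false h = z≤n
edgeIndicator-≤ true false false s h = z≤n
edgeIndicator-≤ false q true false h = z≤n
edgeIndicator-≤ false q false s h = z≤n

-- Equality holds when all endpoints are < n; the bound is all we need.
neighbourSum-mkGraph-≤ : ∀ n es (H : ℕ → ℕ) (j : Fin n) →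
                         neighbourSum (mkGraph n es) (H ∘ toℕ) j ≤ listNeighbourSum es H (toℕ j)
neighbourSum-mkGraph-≤ n [] H j = ℕ.≤-reflexive (∑-zero n)
neighbourSum-mkGraph-≤ n ((u , v) ∷ es) H j = begin
  ∑[ a < n ] ((incident a + edgeMult es (toℕ a) (toℕ j)) * H (toℕ a))
    ≡⟨ sum-cong-≗ (λ a → ℕ.*-distribʳ-+ (H (toℕ a)) (incident a) _) ⟩
  ∑[ a < n ] (incident a * H (toℕ a) + edgeMult es (toℕ a) (toℕ j) * H (toℕ a))
    ≡⟨ ∑-distrib-+ (λ a → incident a * H (toℕ a)) _ ⟩
  ∑[ a < n ] (incident a * H (toℕ a)) + neighbourSum (mkGraph n es) (H ∘ toℕ) j
    ≤⟨ ℕ.+-mono-≤ edge (neighbourSum-mkGraph-≤ n es H j) ⟩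
  edgeNeighbourSum (u , v) H (toℕ j) + listNeighbourSum es H (toℕ j) ∎
  where
  open ℕ.≤-Reasoning
  incident : Fin n → ℕ
  incident a = if ((u ≡ᵇ toℕ a) ∧ (v ≡ᵇ toℕ j)) ∨ ((u ≡ᵇ toℕ j) ∧ (v ≡ᵇ toℕ a)) then 1 else 0
  at : ℕ → Fin n → ℕ
  at w a = if w ≡ᵇ toℕ a then H (toℕ a) else 0
  edge : ∑[ a < n ] (incident a * H (toℕ a)) ≤ edgeNeighbourSum (u , v) H (toℕ j)
  edge = begin
    ∑[ a < n ] (incident a * H (toℕ a))
      ≤⟨ ∑-mono-≤ {n} (λ a →
           edgeIndicator-≤ (u ≡ᵇ toℕ a) (v ≡ᵇ toℕ j) (u ≡ᵇ toℕ j) (v ≡ᵇ toℕ a) (H (toℕ a))) ⟩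
    ∑[ a < n ] ((if v ≡ᵇ toℕ j then at u a else 0) + (if u ≡ᵇ toℕ j then at v a else 0))
      ≡⟨ ∑-distrib-+ (λ a → if v ≡ᵇ toℕ j then at u a else 0)
                     (λ a → if u ≡ᵇ toℕ j then at v a else 0) ⟩
    ∑[ a < n ] (if v ≡ᵇ toℕ j then at u a else 0) + ∑[ a < n ] (if u ≡ᵇ toℕ j then at v a else 0)
      ≡⟨ cong₂ _+_ (∑-if (v ≡ᵇ toℕ j) (at u)) (∑-if (u ≡ᵇ toℕ j) (at v)) ⟩
    (if v ≡ᵇ toℕ j then sum (at u) else 0) + (if u ≡ᵇ toℕ j then sum (at v) else 0)
      ≤⟨ ℕ.+-mono-≤ (if-mono-≤ (v ≡ᵇ toℕ j) (∑-indicator-≤ n u H))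
                    (if-mono-≤ (u ≡ᵇ toℕ j) (∑-indicator-≤ n v H)) ⟩
    edgeNeighbourSum (u , v) H (toℕ j) ∎

mkGraph-subadditive : ∀ {_≺_ : ℕ → ℕ → Set} → Trans _≤_ _≺_ _≺_ → ∀ n es (H : ℕ → ℕ) →
  (∀ i → i < n → 0 < H i) → (∀ j → j < n → listNeighbourSum es H j ≺ (2 * H j)) →
  SubadditiveFunction _≺_ (mkGraph n es)
mkGraph-subadditive ≤-≺-trans n es H positive bound = record
  { value = H ∘ toℕ
  ; positive = λ i → positive (toℕ i) (toℕ<n i)
  ; subadditive = λ j → ≤-≺-trans (neighbourSum-mkGraph-≤ n es H j) (bound (toℕ j) (toℕ<n j))
  }

subadditiveByComputation : ∀ {_≺_ : ℕ → ℕ → Set} (_≺?_ : Decidable _≺_) (G : Graph) (F : Vec ℕ (size G)) →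
  {True (all? λ i → 0 ℕ.<? lookup F i)} →
  {True (all? λ i → neighbourSum G (lookup F) i ≺? (2 * lookup F i))} →
  SubadditiveFunction _≺_ G
subadditiveByComputation _≺?_ G F {positive} {bound} = record
  { value = lookup F
  ; positive = toWitness positive
  ; subadditive = toWitness bound
  }

≡ᵇ-refl : ∀ n → (n ≡ᵇ n) ≡ true
≡ᵇ-refl n = dec-true (n ℕ.≟ n) refl

≢⇒≡ᵇ-false : ∀ {m n} → m ≢ n → (m ≡ᵇ n) ≡ false
≢⇒≡ᵇ-false {m} {n} m≢n = dec-false (m ℕ.≟ n) m≢n

≤⇒<ᵇ-false : ∀ {m n} → n ≤ m → (m <ᵇ n) ≡ false
≤⇒<ᵇ-false {m} {n} n≤m = dec-false (m ℕ.<? n) (ℕ.≤⇒≯ n≤m)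

edge-away : ∀ {j} u v H → u ≢ j → v ≢ j → edgeNeighbourSum (u , v) H j ≡ 0
edge-away u v H u≢j v≢j rewrite ≢⇒≡ᵇ-false u≢j | ≢⇒≡ᵇ-false v≢j = refl

edge-at-source : ∀ u v H → u ≢ v → edgeNeighbourSum (u , v) H u ≡ H v
edge-at-source u v H u≢v rewrite ≢⇒≡ᵇ-false (u≢v ∘ sym) | ≡ᵇ-refl u = refl

edge-at-target : ∀ u v H → u ≢ v → edgeNeighbourSum (u , v) H v ≡ H u
edge-at-target u v H u≢v rewrite ≢⇒≡ᵇ-false u≢v | ≡ᵇ-refl v = ℕ.+-identityʳ (H u)

listNeighbourSum-applyUpTo : ∀ m (g : ℕ → ℕ × ℕ) H j →
  listNeighbourSum (applyUpTo g m) H j ≡ ∑[ i < m ] edgeNeighbourSum (g (toℕ i)) H j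
listNeighbourSum-applyUpTo zero g H j = refl
listNeighbourSum-applyUpTo (suc m) g H j =
  cong (edgeNeighbourSum (g 0) H j +_) (listNeighbourSum-applyUpTo m (g ∘ suc) H j)

predOnPath succOnPath : ℕ → (ℕ → ℕ) → ℕ → ℕ
predOnPath m H zero = 0
predOnPath m H (suc j) = if j <ᵇ m then H j else 0
succOnPath m H j = if j <ᵇ m then H (suc j) else 0

pathNeighbourSum : ∀ m H j → listNeighbourSum (pathEdges (suc m)) H j ≡ predOnPath m H j + succOnPath m H j
pathNeighbourSum m H j = begin
  listNeighbourSum (map (λ i → i , suc i) (applyUpTo id m)) H j
    ≡⟨ cong (λ es → listNeighbourSum es H j) (List.map-applyUpTo id (λ i → i , suc i) m) ⟩
  listNeighbourSum (applyUpTo (λ i → i , suc i) m) H j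
    ≡⟨ listNeighbourSum-applyUpTo m (λ i → i , suc i) H j ⟩
  ∑[ i < m ] (toPred i + toSucc i)
    ≡⟨ ∑-distrib-+ toPred toSucc ⟩
  sum toPred + sum toSucc
    ≡⟨ cong₂ _+_ (predSum j) (∑-indicator m j (H ∘ suc)) ⟩
  predOnPath m H j + succOnPath m H j ∎
  where
  open ≡-Reasoning
  toPred toSucc : Fin m → ℕ
  toPred i = if suc (toℕ i) ≡ᵇ j then H (toℕ i) else 0
  toSucc i = if toℕ i ≡ᵇ j then H (suc (toℕ i)) else 0
  predSum : ∀ v → ∑[ i < m ] (if suc (toℕ i) ≡ᵇ v then H (toℕ i) else 0) ≡ predOnPath m H v
  predSum zero = ∑-zero m
  predSum (suc v) = ∑-indicator m v H

labelBefore : (ℕ → ℕ) → ℕ → ℕ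
labelBefore H zero = 0
labelBefore H (suc j) = H j

predOnPath-≤ : ∀ m H j → predOnPath m H j ≤ labelBefore H j
predOnPath-≤ m H zero = z≤n
predOnPath-≤ m H (suc j) = if-≤ (j <ᵇ m) (H j)

path-≤ : ∀ m H j → listNeighbourSum (pathEdges (suc m)) H j ≤ labelBefore H j + H (suc j)
path-≤ m H j = subst (_≤ labelBefore H j + H (suc j)) (sym (pathNeighbourSum m H j))
                     (ℕ.+-mono-≤ (predOnPath-≤ m H j) (if-≤ (j <ᵇ m) (H (suc j))))

path-end-≤ : ∀ m H → listNeighbourSum (pathEdges (suc m)) H m ≤ labelBefore H m
path-end-≤ m H rewrite pathNeighbourSum m H m | ≤⇒<ᵇ-false (ℕ.≤-refl {m}) =
  ℕ.≤-trans (ℕ.≤-reflexive (ℕ.+-identityʳ _)) (predOnPath-≤ m H m)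

path-beyond : ∀ m H j → m < j → listNeighbourSum (pathEdges (suc m)) H j ≡ 0
path-beyond m H (suc j) (s≤s m≤j)
  rewrite pathNeighbourSum m H (suc j) | ≤⇒<ᵇ-false m≤j | ≤⇒<ᵇ-false (ℕ.m≤n⇒m≤1+n m≤j) = refl

-- Indexed by suc (i + k) so that for a literal i the index reduces to a numeral plus k.
data Position (k : ℕ) : ℕ → Set where
  within : ∀ {j} → j ≤ k → Position k j
  beyond : ∀ i → Position k (suc (i + k))

position : ∀ k j → Position k j
position k j with j ℕ.≤? k
... | yes j≤k = within j≤k
... | no j≰k with ℕ.m≤n⇒∃[o]m+o≡n (ℕ.≰⇒> j≰k)
...   | i , refl = subst (Position k) (cong suc (ℕ.+-comm i k)) (beyond i)

-- Type A: a parabola along the path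

<-by-+ : ∀ {a b} d → a + suc d ≡ b → a < b
<-by-+ {a} d refl = ℕ.m<m+n a z<s

-- (j + 1)(c - j) has second difference -2 and vanishes at j = c.
parabola : ℕ → ℕ → ℕ
parabola c j = suc j * (c ∸ j)

parabola-positive : ∀ {c j} → j < c → 0 < parabola c j
parabola-positive {j = j} j<c = ℕ.*-mono-< (z<s {j}) (ℕ.m<n⇒0<n∸m j<c)

parabola-∸ : ∀ {c} j r → j + r ≡ c → parabola c j ≡ suc j * r
parabola-∸ j r refl = cong (suc j *_) (ℕ.m+n∸m≡n j r)

parabola-concave : ∀ {c j} → 2 + j ≤ c → parabola c j + parabola c (2 + j) + 2 ≡ 2 * parabola c (suc j)
parabola-concave {c} {j} 2+j≤c with ℕ.m≤n⇒∃[o]m+o≡n 2+j≤c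
... | s , refl = begin
  parabola c j + parabola c (2 + j) + 2
    ≡⟨ cong₂ (λ x y → x + y + 2) (parabola-∸ j (2 + s) (e₁ j s)) (parabola-∸ (2 + j) s refl) ⟩
  suc j * (2 + s) + (3 + j) * s + 2
    ≡⟨ e₂ j s ⟩
  2 * ((2 + j) * (1 + s))
    ≡⟨ cong (2 *_) (parabola-∸ (suc j) (1 + s) (e₃ j s)) ⟨
  2 * parabola c (suc j) ∎
  where
  open ≡-Reasoning
  e₁ : ∀ j s → j + (2 + s) ≡ 2 + j + s
  e₁ = solve-∀
  e₂ : ∀ j s → suc j * (2 + s) + (3 + j) * s + 2 ≡ 2 * ((2 + j) * (1 + s))
  e₂ = solve-∀
  e₃ : ∀ j s → suc j + (1 + s) ≡ 2 + j + s
  e₃ = solve-∀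

parabola-subadditive : ∀ {c} j → j < c → labelBefore (parabola c) j + parabola c (suc j) < 2 * parabola c j
parabola-subadditive {suc c} zero _ = <-by-+ 1 (e c)
  where
  e : ∀ c → 2 * c + 2 ≡ 2 * (1 * suc c)
  e = solve-∀
parabola-subadditive (suc j) 1+j<c = <-by-+ 1 (parabola-concave 1+j<c)

A-subadditive : ∀ k → SubadditiveFunction _<_ (finiteDiagram (A k))
A-subadditive k = mkGraph-subadditive ℕ.≤-<-trans (suc k) (pathEdges (suc k)) (parabola (suc k))
  (λ _ → parabola-positive)
  (λ j j<1+k → ℕ.≤-<-trans (path-≤ k (parabola (suc k)) j) (parabola-subadditive j j<1+k))

-- Type D: the parabola up to the fork, and just over half the fork's label on the two leaves

-- The diagrams number vertices as k + c, which is stuck on k; c + k reduces, so the edge lists are rewritten once.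
D-edges : ℕ → List (ℕ × ℕ)
D-edges k = (suc k , 3 + k) ∷ pathEdges (3 + k)

finiteDiagram-D : ∀ k → finiteDiagram (D k) ≡ mkGraph (4 + k) (D-edges k)
finiteDiagram-D k = cong₂ mkGraph (ℕ.+-comm k 4)
  (cong₂ _∷_ (cong₂ _,_ (ℕ.+-comm k 1) (ℕ.+-comm k 3)) (cong pathEdges (ℕ.+-comm k 3)))

module _ (k : ℕ) where

  private
    P : ℕ → ℕ
    P = parabola (4 + 2 * k)
    L : ℕ
    L = suc (P (suc k))

  D-label : ℕ → ℕ
  D-label j = if j <ᵇ 2 + k then 2 * P j else L

  D-label-stem : ∀ {j} → j < 2 + k → D-label j ≡ 2 * P j
  D-label-stem {j} j<2+k rewrite dec-true (j ℕ.<? 2 + k) j<2+k = refl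

  D-label-leaf : ∀ {j} → 2 + k ≤ j → D-label j ≡ L
  D-label-leaf 2+k≤j rewrite ≤⇒<ᵇ-false 2+k≤j = refl

  D-label-positive : ∀ j → 0 < D-label j
  D-label-positive j with j ℕ.<? 2 + k
  ... | yes j<2+k = subst (0 <_) (sym (D-label-stem j<2+k))
                          (ℕ.*-monoʳ-< 2 (parabola-positive (ℕ.<-≤-trans j<2+k 2+k≤4+2k)))
    where
    2+k≤4+2k : 2 + k ≤ 4 + 2 * k
    2+k≤4+2k = ℕ.+-mono-≤ (ℕ.m≤m+n 2 2) (ℕ.m≤n*m k 2)
  ... | no j≮2+k = subst (0 <_) (sym (D-label-leaf (ℕ.≮⇒≥ j≮2+k))) z<s

  D-label-before : ∀ {j} → j ≤ 2 + k → labelBefore D-label j ≡ 2 * labelBefore P j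
  D-label-before {zero} _ = refl
  D-label-before {suc j} 1+j≤2+k = D-label-stem 1+j≤2+k

  D-fork<2*leaf : ∀ {j} → 2 + k ≤ j → D-label (suc k) < 2 * D-label j
  D-fork<2*leaf {j} 2+k≤j = begin-strict
    D-label (suc k)   ≡⟨ D-label-stem (ℕ.n<1+n (suc k)) ⟩
    2 * P (suc k)     <⟨ ℕ.*-monoʳ-< 2 (ℕ.n<1+n (P (suc k))) ⟩
    2 * L             ≡⟨ cong (2 *_) (D-label-leaf 2+k≤j) ⟨
    2 * D-label j     ∎
    where open ℕ.≤-Reasoning

  D-stem-bound : ∀ {j} → j ≤ k → listNeighbourSum (D-edges k) D-label j < 2 * D-label j
  D-stem-bound {j} j≤k = begin-strict
    edgeNeighbourSum (suc k , 3 + k) D-label j + listNeighbourSum (pathEdges (3 + k)) D-label j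
      ≡⟨ cong (_+ listNeighbourSum (pathEdges (3 + k)) D-label j)
              (edge-away (suc k) (3 + k) D-label (ℕ.>⇒≢ (s≤s j≤k))
                         (ℕ.>⇒≢ (ℕ.≤-<-trans j≤k (ℕ.m<n+m k {3} z<s)))) ⟩
    listNeighbourSum (pathEdges (3 + k)) D-label j
      ≤⟨ path-≤ (2 + k) D-label j ⟩
    labelBefore D-label j + D-label (suc j)
      ≡⟨ cong₂ _+_ (D-label-before (ℕ.m≤n⇒m≤o+n 2 j≤k)) (D-label-stem (s≤s (s≤s j≤k))) ⟩
    2 * labelBefore P j + 2 * P (suc j)
      ≡⟨ ℕ.*-distribˡ-+ 2 (labelBefore P j) (P (suc j)) ⟨
    2 * (labelBefore P j + P (suc j))
      <⟨ ℕ.*-monoʳ-< 2 (parabola-subadditive j (ℕ.≤-<-trans j≤k k<4+2k)) ⟩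
    2 * (2 * P j)
      ≡⟨ cong (2 *_) (D-label-stem (ℕ.≤-<-trans j≤k (ℕ.m<n+m k {2} z<s))) ⟨
    2 * D-label j ∎
    where
    open ℕ.≤-Reasoning
    k<4+2k : k < 4 + 2 * k
    k<4+2k = ℕ.≤-<-trans (ℕ.m≤n*m k 2) (ℕ.m<n+m (2 * k) {4} z<s)

  D-fork-bound : listNeighbourSum (D-edges k) D-label (suc k) < 2 * D-label (suc k)
  D-fork-bound = begin-strict
    edgeNeighbourSum (suc k , 3 + k) D-label (suc k) + listNeighbourSum (pathEdges (3 + k)) D-label (suc k)
      ≤⟨ ℕ.+-monoʳ-≤ (edgeNeighbourSum (suc k , 3 + k) D-label (suc k)) (path-≤ (2 + k) D-label (suc k)) ⟩
    edgeNeighbourSum (suc k , 3 + k) D-label (suc k) + (D-label k + D-label (2 + k))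
      ≡⟨ cong₂ _+_ (trans (edge-at-source (suc k) (3 + k) D-label (ℕ.m≢1+n+m (suc k) {1}))
                          (D-label-leaf (ℕ.n≤1+n (2 + k))))
                   (cong₂ _+_ (D-label-stem (ℕ.m<n+m k {2} z<s)) (D-label-leaf ℕ.≤-refl)) ⟩
    L + (2 * P k + L)
      ≡⟨ cong₂ (λ x y → suc y + (2 * x + suc y))
               (parabola-∸ k (4 + k) (e₁ k)) (parabola-∸ (suc k) (3 + k) (e₂ k)) ⟩
    suc ((2 + k) * (3 + k)) + (2 * (suc k * (4 + k)) + suc ((2 + k) * (3 + k)))
      <⟨ <-by-+ 1 (e₃ k) ⟩
    2 * (2 * ((2 + k) * (3 + k)))
      ≡⟨ cong (2 *_) (trans (D-label-stem (ℕ.n<1+n (suc k))) (cong (2 *_) (parabola-∸ (suc k) (3 + k) (e₂ k)))) ⟨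
    2 * D-label (suc k) ∎
    where
    open ℕ.≤-Reasoning
    e₁ : ∀ k → k + (4 + k) ≡ 4 + 2 * k
    e₁ = solve-∀
    e₂ : ∀ k → suc k + (3 + k) ≡ 4 + 2 * k
    e₂ = solve-∀
    e₃ : ∀ k → suc ((2 + k) * (3 + k)) + (2 * (suc k * (4 + k)) + suc ((2 + k) * (3 + k))) + 2 ≡
               2 * (2 * ((2 + k) * (3 + k)))
    e₃ = solve-∀

  D-end-bound : listNeighbourSum (D-edges k) D-label (2 + k) < 2 * D-label (2 + k)
  D-end-bound = begin-strict
    edgeNeighbourSum (suc k , 3 + k) D-label (2 + k) + listNeighbourSum (pathEdges (3 + k)) D-label (2 + k)
      ≡⟨ cong (_+ listNeighbourSum (pathEdges (3 + k)) D-label (2 + k))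
              (edge-away (suc k) (3 + k) D-label (ℕ.m≢1+n+m (suc k) {0}) (≢-sym (ℕ.m≢1+n+m (2 + k) {0}))) ⟩
    listNeighbourSum (pathEdges (3 + k)) D-label (2 + k)
      ≤⟨ path-end-≤ (2 + k) D-label ⟩
    D-label (suc k)
      <⟨ D-fork<2*leaf ℕ.≤-refl ⟩
    2 * D-label (2 + k) ∎
    where open ℕ.≤-Reasoning

  D-extraLeaf-bound : listNeighbourSum (D-edges k) D-label (3 + k) < 2 * D-label (3 + k)
  D-extraLeaf-bound = begin-strict
    edgeNeighbourSum (suc k , 3 + k) D-label (3 + k) + listNeighbourSum (pathEdges (3 + k)) D-label (3 + k)
      ≡⟨ cong₂ _+_ (edge-at-target (suc k) (3 + k) D-label (ℕ.m≢1+n+m (suc k) {1}))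
                   (path-beyond (2 + k) D-label (3 + k) (ℕ.n<1+n (2 + k))) ⟩
    D-label (suc k) + 0
      ≡⟨ ℕ.+-identityʳ (D-label (suc k)) ⟩
    D-label (suc k)
      <⟨ D-fork<2*leaf (ℕ.n≤1+n (2 + k)) ⟩
    2 * D-label (3 + k) ∎
    where open ℕ.≤-Reasoning

  D-bound : ∀ j → j < 4 + k → listNeighbourSum (D-edges k) D-label j < 2 * D-label j
  D-bound j j<4+k with position k j
  ... | within j≤k = D-stem-bound j≤k
  D-bound _ _ | beyond 0 = D-fork-bound
  D-bound _ _ | beyond 1 = D-end-bound
  D-bound _ _ | beyond 2 = D-extraLeaf-bound
  D-bound _ (s≤s (s≤s (s≤s (s≤s i+k<k)))) | beyond (suc (suc (suc i))) = ⊥-elim (ℕ.m+n≮n i k i+k<k)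

D-subadditive : ∀ k → SubadditiveFunction _<_ (finiteDiagram (D k))
D-subadditive k = subst (SubadditiveFunction _<_) (sym (finiteDiagram-D k))
  (mkGraph-subadditive ℕ.≤-<-trans (4 + k) (D-edges k) (D-label k) (λ j _ → D-label-positive k j) (D-bound k))

-- Type Ã: the constant function on a cycle

cycleEdges-path : ∀ k → cycleEdges (suc k) ≡ pathEdges (2 + k) ++ (suc k , 0) ∷ []
cycleEdges-path k = begin
  map edge (upTo (2 + k))                        ≡⟨ cong (map edge) (List.applyUpTo-∷ʳ id (suc k)) ⟨
  map edge (upTo (suc k) ∷ʳ suc k)               ≡⟨ List.map-++ edge (upTo (suc k)) (suc k ∷ []) ⟩
  map edge (upTo (suc k)) ++ edge (suc k) ∷ []   ≡⟨ cong₂ _++_ (List.map-cong-local onPath)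
                                                              (cong (λ x → (suc k , x) ∷ []) (n%n≡0 (2 + k))) ⟩
  pathEdges (2 + k) ++ (suc k , 0) ∷ []          ∎
  where
  open ≡-Reasoning
  edge : ℕ → ℕ × ℕ
  edge i = i , suc i % (2 + k)
  onPath : All (λ i → edge i ≡ (i , suc i)) (upTo (suc k))
  onPath = applyUpTo⁺₁ id (suc k) (λ {i} i<1+k → cong (i ,_) (m<n⇒m%n≡m (s≤s i<1+k)))

Ã-vertex-bound : ∀ k j → j < 2 + k →
  listNeighbourSum (pathEdges (2 + k)) (const 1) j + listNeighbourSum ((suc k , 0) ∷ []) (const 1) j ≤ 2
Ã-vertex-bound k j j<2+k with position k j
... | within {zero} _ = ℕ.+-mono-≤ (path-≤ (suc k) (const 1) 0) ℕ.≤-refl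
... | within {suc i} 1+i≤k = ℕ.+-mono-≤ (path-≤ (suc k) (const 1) (suc i))
        (ℕ.≤-reflexive (cong (_+ 0) (edge-away (suc k) 0 (const 1) (ℕ.>⇒≢ (s≤s 1+i≤k)) λ ())))
... | beyond 0 = ℕ.+-mono-≤ (path-end-≤ (suc k) (const 1))
        (ℕ.≤-reflexive (cong (_+ 0) (edge-at-source (suc k) 0 (const 1) λ ())))
Ã-vertex-bound k _ (s≤s (s≤s i+k<k)) | beyond (suc i) = ⊥-elim (ℕ.m+n≮n i k i+k<k)

Ã-subadditive : ∀ k → SubadditiveFunction _≤_ (affineDiagram (Ã k))
Ã-subadditive k = mkGraph-subadditive ℕ.≤-trans (k + 2) (cycleEdges (suc k)) (const 1) (λ _ _ → z<s) bound
  where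
  bound : ∀ j → j < k + 2 → listNeighbourSum (cycleEdges (suc k)) (const 1) j ≤ 2 * 1
  bound j j<k+2 = begin
    listNeighbourSum (cycleEdges (suc k)) (const 1) j
      ≡⟨ cong (λ es → listNeighbourSum es (const 1) j) (cycleEdges-path k) ⟩
    listNeighbourSum (pathEdges (2 + k) ++ (suc k , 0) ∷ []) (const 1) j
      ≡⟨ listNeighbourSum-++ (pathEdges (2 + k)) ((suc k , 0) ∷ []) (const 1) j ⟩
    listNeighbourSum (pathEdges (2 + k)) (const 1) j + listNeighbourSum ((suc k , 0) ∷ []) (const 1) j
      ≤⟨ Ã-vertex-bound k j (subst (j <_) (ℕ.+-comm k 2) j<k+2) ⟩
    2 ∎
    where open ℕ.≤-Reasoning

-- Type D̃: the minimal imaginary root, 1 on the four leaves and 2 inside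

D̃-edges : ℕ → List (ℕ × ℕ)
D̃-edges k = (1 , 3 + k) ∷ (suc k , 4 + k) ∷ pathEdges (3 + k)

affineDiagram-D̃ : ∀ k → affineDiagram (D̃ k) ≡ mkGraph (5 + k) (D̃-edges k)
affineDiagram-D̃ k = cong₂ mkGraph (ℕ.+-comm k 5)
  (cong₂ _∷_ (cong (1 ,_) (ℕ.+-comm k 3))
    (cong₂ _∷_ (cong₂ _,_ (ℕ.+-comm k 1) (ℕ.+-comm k 4)) (cong pathEdges (ℕ.+-comm k 3))))

module _ (k : ℕ) where

  D̃-label : ℕ → ℕ
  D̃-label zero = 1
  D̃-label (suc j) = if j <ᵇ suc k then 2 else 1

  D̃-label-positive : ∀ j → 0 < D̃-label j
  D̃-label-positive zero = z<s
  D̃-label-positive (suc j) with j <ᵇ suc k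
  ... | true = z<s
  ... | false = z<s

  D̃-label-inner : ∀ {j} → j ≤ k → D̃-label (suc j) ≡ 2
  D̃-label-inner {j} j≤k rewrite dec-true (j ℕ.<? suc k) (s≤s j≤k) = refl

  D̃-label-leaf : ∀ {j} → suc k ≤ j → D̃-label (suc j) ≡ 1
  D̃-label-leaf 1+k≤j rewrite ≤⇒<ᵇ-false 1+k≤j = refl

  -- An inner vertex i + 1 loses a neighbour of label 2 exactly when it gains a leaf (at i = 0 and at i = k).
  D̃-left-balance : ∀ i → i ≤ suc k → (if 0 ≡ᵇ i then 1 else 0) + D̃-label i ≡ 2
  D̃-left-balance zero _ = refl
  D̃-left-balance (suc i) (s≤s i≤k) = D̃-label-inner i≤k

  D̃-right-balance : ∀ i → i ≤ k → (if k ≡ᵇ i then 1 else 0) + D̃-label (2 + i) ≡ 2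
  D̃-right-balance i i≤k = go i k i≤k
    where
    go : ∀ i k → i ≤ k → (if k ≡ᵇ i then 1 else 0) + (if i <ᵇ k then 2 else 1) ≡ 2
    go zero zero _ = refl
    go zero (suc k) _ = refl
    go (suc i) (suc k) (s≤s i≤k) = go i k i≤k

  D̃-inner-bound : ∀ {i} → i ≤ k → listNeighbourSum (D̃-edges k) D̃-label (suc i) ≤ 2 * D̃-label (suc i)
  D̃-inner-bound {i} i≤k = begin
    edgeNeighbourSum (1 , 3 + k) D̃-label (suc i) +
      (edgeNeighbourSum (suc k , 4 + k) D̃-label (suc i) + listNeighbourSum (pathEdges (3 + k)) D̃-label (suc i))
      ≤⟨ ℕ.+-mono-≤ (ℕ.≤-reflexive left)
                    (ℕ.+-mono-≤ (ℕ.≤-reflexive right) (path-≤ (2 + k) D̃-label (suc i))) ⟩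
    (if 0 ≡ᵇ i then 1 else 0) + ((if k ≡ᵇ i then 1 else 0) + (D̃-label i + D̃-label (2 + i)))
      ≡⟨ rearrange (if 0 ≡ᵇ i then 1 else 0) (if k ≡ᵇ i then 1 else 0) (D̃-label i) (D̃-label (2 + i)) ⟩
    ((if 0 ≡ᵇ i then 1 else 0) + D̃-label i) + ((if k ≡ᵇ i then 1 else 0) + D̃-label (2 + i))
      ≡⟨ cong₂ _+_ (D̃-left-balance i (ℕ.m≤n⇒m≤1+n i≤k)) (D̃-right-balance i i≤k) ⟩
    2 * 2
      ≡⟨ cong (2 *_) (D̃-label-inner i≤k) ⟨
    2 * D̃-label (suc i) ∎
    where
    open ℕ.≤-Reasoning
    left : edgeNeighbourSum (1 , 3 + k) D̃-label (suc i) ≡ (if 0 ≡ᵇ i then 1 else 0)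
    left rewrite ≢⇒≡ᵇ-false (ℕ.>⇒≢ (ℕ.≤-<-trans i≤k (ℕ.m<n+m k {2} z<s)))
               | D̃-label-leaf (ℕ.n≤1+n (suc k)) = refl
    right : edgeNeighbourSum (suc k , 4 + k) D̃-label (suc i) ≡ (if k ≡ᵇ i then 1 else 0)
    right rewrite ≢⇒≡ᵇ-false (ℕ.>⇒≢ (ℕ.≤-<-trans i≤k (ℕ.m<n+m k {3} z<s)))
                | D̃-label-leaf (ℕ.m≤n+m (suc k) 2) = refl
    rearrange : ∀ a b c d → a + (b + (c + d)) ≡ (a + c) + (b + d)
    rearrange = solve-∀

  D̃-end-bound : listNeighbourSum (D̃-edges k) D̃-label (2 + k) ≤ 2 * D̃-label (2 + k)
  D̃-end-bound = begin
    edgeNeighbourSum (1 , 3 + k) D̃-label (2 + k) +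
      (edgeNeighbourSum (suc k , 4 + k) D̃-label (2 + k) + listNeighbourSum (pathEdges (3 + k)) D̃-label (2 + k))
      ≡⟨ cong₂ (λ x y → x + (y + listNeighbourSum (pathEdges (3 + k)) D̃-label (2 + k)))
           (edge-away 1 (3 + k) D̃-label (λ ()) (≢-sym (ℕ.m≢1+n+m (2 + k) {0})))
           (edge-away (suc k) (4 + k) D̃-label (ℕ.m≢1+n+m (suc k) {0}) (≢-sym (ℕ.m≢1+n+m (2 + k) {1}))) ⟩
    listNeighbourSum (pathEdges (3 + k)) D̃-label (2 + k)
      ≤⟨ path-end-≤ (2 + k) D̃-label ⟩
    D̃-label (suc k)
      ≡⟨ D̃-label-inner ℕ.≤-refl ⟩
    2
      ≡⟨ cong (2 *_) (D̃-label-leaf ℕ.≤-refl) ⟨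
    2 * D̃-label (2 + k) ∎
    where open ℕ.≤-Reasoning

  D̃-leaf₁-bound : listNeighbourSum (D̃-edges k) D̃-label (3 + k) ≤ 2 * D̃-label (3 + k)
  D̃-leaf₁-bound = ℕ.≤-reflexive (begin
    edgeNeighbourSum (1 , 3 + k) D̃-label (3 + k) +
      (edgeNeighbourSum (suc k , 4 + k) D̃-label (3 + k) + listNeighbourSum (pathEdges (3 + k)) D̃-label (3 + k))
      ≡⟨ cong₂ _+_ (edge-at-target 1 (3 + k) D̃-label (λ ()))
           (cong₂ _+_ (edge-away (suc k) (4 + k) D̃-label (ℕ.m≢1+n+m (suc k) {1}) (≢-sym (ℕ.m≢1+n+m (3 + k) {0})))
                      (path-beyond (2 + k) D̃-label (3 + k) (ℕ.n<1+n (2 + k)))) ⟩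
    2
      ≡⟨ cong (2 *_) (D̃-label-leaf (ℕ.n≤1+n (suc k))) ⟨
    2 * D̃-label (3 + k) ∎)
    where open ≡-Reasoning

  D̃-leaf₂-bound : listNeighbourSum (D̃-edges k) D̃-label (4 + k) ≤ 2 * D̃-label (4 + k)
  D̃-leaf₂-bound = ℕ.≤-reflexive (begin
    edgeNeighbourSum (1 , 3 + k) D̃-label (4 + k) +
      (edgeNeighbourSum (suc k , 4 + k) D̃-label (4 + k) + listNeighbourSum (pathEdges (3 + k)) D̃-label (4 + k))
      ≡⟨ cong₂ _+_ (edge-away 1 (3 + k) D̃-label (λ ()) (ℕ.m≢1+n+m (3 + k) {0}))
           (cong₂ _+_ (trans (edge-at-target (suc k) (4 + k) D̃-label (ℕ.m≢1+n+m (suc k) {2}))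
                             (D̃-label-inner ℕ.≤-refl))
                      (path-beyond (2 + k) D̃-label (4 + k) (ℕ.m<n+m (2 + k) {2} z<s))) ⟩
    2
      ≡⟨ cong (2 *_) (D̃-label-leaf (ℕ.m≤n+m (suc k) 2)) ⟨
    2 * D̃-label (4 + k) ∎)
    where open ≡-Reasoning

  D̃-bound : ∀ j → j < 5 + k → listNeighbourSum (D̃-edges k) D̃-label j ≤ 2 * D̃-label j
  D̃-bound j j<5+k with position (suc k) j
  ... | within {zero} _ = path-≤ (2 + k) D̃-label 0
  ... | within {suc i} (s≤s i≤k) = D̃-inner-bound i≤k
  D̃-bound _ _ | beyond 0 = D̃-end-bound
  D̃-bound _ _ | beyond 1 = D̃-leaf₁-bound
  D̃-bound _ _ | beyond 2 = D̃-leaf₂-bound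
  D̃-bound _ (s≤s (s≤s (s≤s (s≤s (s≤s i+1+k≤k))))) | beyond (suc (suc (suc i))) =
    ⊥-elim (ℕ.1+n≰n (ℕ.m+n≤o⇒n≤o i i+1+k≤k))

D̃-subadditive : ∀ k → SubadditiveFunction _≤_ (affineDiagram (D̃ k))
D̃-subadditive k = subst (SubadditiveFunction _≤_) (sym (affineDiagram-D̃ k))
  (mkGraph-subadditive ℕ.≤-trans (5 + k) (D̃-edges k) (D̃-label k) (λ j _ → D̃-label-positive k j) (D̃-bound k))

-- Types E and Ẽ, checked by evaluation

E6-subadditive : SubadditiveFunction _<_ (finiteDiagram E6)
E6-subadditive = subadditiveByComputation ℕ._<?_ (finiteDiagram E6) (10 ∷ 19 ∷ 27 ∷ 19 ∷ 10 ∷ 14 ∷ [])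

E7-subadditive : SubadditiveFunction _<_ (finiteDiagram E7)
E7-subadditive = subadditiveByComputation ℕ._<?_ (finiteDiagram E7) (64 ∷ 127 ∷ 185 ∷ 144 ∷ 98 ∷ 50 ∷ 94 ∷ [])

E8-subadditive : SubadditiveFunction _<_ (finiteDiagram E8)
E8-subadditive = subadditiveByComputation ℕ._<?_ (finiteDiagram E8)
  (162 ∷ 322 ∷ 478 ∷ 389 ∷ 296 ∷ 199 ∷ 100 ∷ 240 ∷ [])

-- The labels are the coefficients of the minimal imaginary root δ, so these are additive.

Ẽ6-subadditive : SubadditiveFunction _≤_ (affineDiagram Ẽ6)
Ẽ6-subadditive = subadditiveByComputation ℕ._≤?_ (affineDiagram Ẽ6) (1 ∷ 2 ∷ 3 ∷ 2 ∷ 1 ∷ 2 ∷ 1 ∷ [])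

Ẽ7-subadditive : SubadditiveFunction _≤_ (affineDiagram Ẽ7)
Ẽ7-subadditive = subadditiveByComputation ℕ._≤?_ (affineDiagram Ẽ7) (1 ∷ 2 ∷ 3 ∷ 4 ∷ 3 ∷ 2 ∷ 1 ∷ 2 ∷ [])

Ẽ8-subadditive : SubadditiveFunction _≤_ (affineDiagram Ẽ8)
Ẽ8-subadditive = subadditiveByComputation ℕ._≤?_ (affineDiagram Ẽ8)
  (2 ∷ 4 ∷ 6 ∷ 5 ∷ 4 ∷ 3 ∷ 2 ∷ 1 ∷ 3 ∷ [])

finite-subadditive : ∀ X → SubadditiveFunction _<_ (finiteDiagram X)
finite-subadditive (A k) = A-subadditive k
finite-subadditive (D k) = D-subadditive k
finite-subadditive E6 = E6-subadditive
finite-subadditive E7 = E7-subadditive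
finite-subadditive E8 = E8-subadditive

affine-subadditive : ∀ Y → SubadditiveFunction _≤_ (affineDiagram Y)
affine-subadditive (Ã k) = Ã-subadditive k
affine-subadditive (D̃ k) = D̃-subadditive k
affine-subadditive Ẽ6 = Ẽ6-subadditive
affine-subadditive Ẽ7 = Ẽ7-subadditive
affine-subadditive Ẽ8 = Ẽ8-subadditive

finiteDiagram-symmetric : ∀ X → Symmetric (finiteDiagram X)
finiteDiagram-symmetric (A k) = mkGraph-symmetric (suc k) (pathEdges (suc k))
finiteDiagram-symmetric (D k) = mkGraph-symmetric (k + 4) ((k + 1 , k + 3) ∷ pathEdges (k + 3))
finiteDiagram-symmetric E6 = mkGraph-symmetric 6 ((2 , 5) ∷ pathEdges 5)
finiteDiagram-symmetric E7 = mkGraph-symmetric 7 ((2 , 6) ∷ pathEdges 6)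
finiteDiagram-symmetric E8 = mkGraph-symmetric 8 ((2 , 7) ∷ pathEdges 7)

affineDiagram-symmetric : ∀ Y → Symmetric (affineDiagram Y)
affineDiagram-symmetric (Ã k) = mkGraph-symmetric (k + 2) (cycleEdges (suc k))
affineDiagram-symmetric (D̃ k) = mkGraph-symmetric (k + 5) ((1 , k + 3) ∷ (k + 1 , k + 4) ∷ pathEdges (k + 3))
affineDiagram-symmetric Ẽ6 = mkGraph-symmetric 7 ((2 , 5) ∷ (5 , 6) ∷ pathEdges 5)
affineDiagram-symmetric Ẽ7 = mkGraph-symmetric 8 ((3 , 7) ∷ pathEdges 7)
affineDiagram-symmetric Ẽ8 = mkGraph-symmetric 9 ((2 , 8) ∷ pathEdges 8)

mainTheorem3 :
  ((X Y : FiniteADE) →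
    (cx : Colouring (finiteDiagram X)) → ProperColouring (finiteDiagram X) cx →
    (cy : Colouring (finiteDiagram Y)) → ProperColouring (finiteDiagram Y) cy →
    Σ (Labelling (finiteDiagram X) (finiteDiagram Y) cx cy)
      (IsStrictlySubadditive (finiteDiagram X) (finiteDiagram Y) cx cy))
  ×
  ((X : FiniteADE) → (Y : AffineADE) →
    (cx : Colouring (finiteDiagram X)) → ProperColouring (finiteDiagram X) cx →
    (cy : Colouring (affineDiagram Y)) → ProperColouring (affineDiagram Y) cy →
    Σ (Labelling (finiteDiagram X) (affineDiagram Y) cx cy)
      (IsSubadditive (finiteDiagram X) (affineDiagram Y) cx cy))
  ×
  ((X Y : AffineADE) →
    (cx : Colouring (affineDiagram X)) → ProperColouring (affineDiagram X) cx →
    (cy : Colouring (affineDiagram Y)) → ProperColouring (affineDiagram Y) cy →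
    Σ (Labelling (affineDiagram X) (affineDiagram Y) cx cy)
      (IsWeaklySubadditive (affineDiagram X) (affineDiagram Y) cx cy))
mainTheorem3 =
    (λ X Y cx _ cy _ → box-strictlySubadditive (finiteDiagram-symmetric X) (finiteDiagram-symmetric Y) cx cy
                         (finite-subadditive X) (finite-subadditive Y))
  , (λ X Y cx _ cy _ → box-subadditive (finiteDiagram-symmetric X) (affineDiagram-symmetric Y) cx cy
                         (finite-subadditive X) (affine-subadditive Y))
  , (λ X Y cx _ cy _ → box-weaklySubadditive (affineDiagram-symmetric X) (affineDiagram-symmetric Y) cx cy
                         (affine-subadditive X) (affine-subadditive Y))
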